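{- Let $G$ be a connected graph, let $e=uv$ be an edge of $G$, and let $x,y\in W_{uv}\cup {}_vW_u$. Then $\mathcal{P}_G(x,y)=\mathcal{P}_{G-e}(x,y)$. In particular, $d_G(x,y)=d_{G-e}(x,y)$.
   Context: All graphs are simple; $d_G(a,b)$ denotes the distance in $G$. For an edge $uv$ of $G$: $W_{uv}=\{w\in V(G): d_G(u,w)<d_G(v,w)\}$ and ${}_vW_u=\{w\in V(G): d_G(u,w)=d_G(v,w)\}$. For vertices $a,b$ of a graph $H$, $\mathcal{P}_H(a,b)$ denotes the set of all shortest $a,b$-paths in $H$. $G-e$ is the graph obtained from $G$ by deleting the edge $e$. -}

module Defs where

open import Level using (0ℓ)
open import Data.Nat using (ℕ; suc; _≤_; _<_)
open import Data.Fin using (Fin)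
open import Data.List using (List; []; _∷_; length)
open import Data.List.Relation.Unary.Unique.Propositional using (Unique)
open import Data.Product using (Σ; _×_; _,_; ∃)
open import Relation.Nullary using (¬_)
open import Relation.Binary.PropositionalEquality using (_≡_)

record Graph (n : ℕ) : Set₁ where
  field
    Adj    : Fin n → Fin n → Set
    sym    : ∀ {a b} → Adj a b → Adj b a
    irrefl : ∀ {a} → ¬ Adj a a
open Graph public

module _ {n : ℕ} where

  data IsWalk (G : Graph n) : List (Fin n) → Fin n → Fin n → Set where
    single : ∀ {a} → IsWalk G (a ∷ []) a a
    step   : ∀ {a b c p} → Adj G a b → IsWalk G (b ∷ p) b c →
             IsWalk G (a ∷ b ∷ p) a c

  IsPath : Graph n → List (Fin n) → Fin n → Fin n → Set
  IsPath G p a b = IsWalk G p a b × Unique p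

  edges : List (Fin n) → ℕ
  edges []      = 0
  edges (_ ∷ p) = length p

  -- p is a shortest a,b-path in G, i.e. p ∈ 𝒫_G(a,b)
  IsShortestPath : Graph n → List (Fin n) → Fin n → Fin n → Set
  IsShortestPath G p a b =
    IsPath G p a b × (∀ q → IsPath G q a b → edges p ≤ edges q)

  Dist : Graph n → Fin n → Fin n → ℕ → Set
  Dist G a b k = Σ (List (Fin n)) λ p → IsShortestPath G p a b × edges p ≡ k

  Connected : Graph n → Set
  Connected G = ∀ a b → ∃ λ p → IsWalk G p a b

  deleteEdge : (G : Graph n) (u v : Fin n) → Graph n
  deleteEdge G u v = record
    { Adj    = λ a b → Adj G a b × ¬ (a ≡ u × b ≡ v) × ¬ (a ≡ v × b ≡ u)
    ; sym    = λ { (h , p , q) → sym G h , (λ { (x , y) → q (y , x) }) , (λ { (x , y) → p (y , x) }) }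
    ; irrefl = λ { (h , _) → irrefl G h }
    }

  -- w ∈ W_uv : d_G(u,w) < d_G(v,w)
  InW : Graph n → Fin n → Fin n → Fin n → Set
  InW G u v w = ∃ λ k → ∃ λ l → Dist G u w k × Dist G v w l × k < l

  -- w ∈ _vW_u : d_G(u,w) = d_G(v,w)
  InEq : Graph n → Fin n → Fin n → Fin n → Set
  InEq G u v w = ∃ λ k → Dist G u w k × Dist G v w k

-- Let k = d(u,x) and l = d(u,y). Since x and y are not closer to v than to u, every walk from u or
-- from v to x has at least k edges, and likewise l edges to y. A walk that traverses uv splits at
-- that edge into a walk from x to an end of uv and a walk from an end of uv to y, so it has more
-- than k + l edges. A geodesic from u to x cannot traverse uv (its part after the edge would be a
-- walk from an end shorter than k), so x, u, y are joined in G - e by a walk, and hence a path,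
-- with at most k + l edges. Thus no shortest x,y-path of G or of G - e uses uv, and the two
-- graphs have the same shortest x,y-paths.
{-# OPTIONS --safe #-}
module Submission where

open import Defs
open import Data.Nat using (ℕ; suc; _+_; _≤_; _<_; z≤n; s≤s)
open import Data.Nat.Properties
  using (suc-injective; ≤-refl; ≤-trans; ≤-reflexive; <⇒≤; ≤-<-trans; <⇒≱; m≤n⇒m≤1+n; m≤n+m; +-mono-≤-<)
open import Data.Fin using (Fin; _≟_)
open import Data.List using (List; []; _∷_; _++_; _∷ʳ_; length; reverse; drop)
open import Data.List.Properties using (unfold-reverse; length-reverse)
open import Data.List.Membership.Propositional using (_∈_)
open import Data.List.Relation.Unary.Any using (here; there)
open import Data.List.Relation.Unary.All using ([])
open import Data.List.Relation.Unary.All.Properties using (¬Any⇒All¬)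
open import Data.List.Relation.Unary.AllPairs using ([]; _∷_)
open import Data.Product using (∃; _×_; _,_)
open import Data.Sum using (_⊎_; inj₁; inj₂; map₂)
open import Data.Empty using (⊥-elim)
open import Relation.Nullary using (yes; no)
open import Relation.Nullary.Decidable using (_×-dec_)
open import Relation.Binary.PropositionalEquality as ≡ using (_≡_; refl; cong; subst; module ≡-Reasoning)
open import Function.Bundles using (_⇔_; mk⇔; Equivalence)

module _ {n : ℕ} {G : Graph n} where
  open import Data.List.Membership.DecPropositional (_≟_ {n}) using (_∈?_)

  walk-∷ : ∀ {a b c q} → Adj G a b → IsWalk G q b c → IsWalk G (a ∷ q) a c
  walk-∷ a~b single     = step a~b single
  walk-∷ a~b (step h w) = step a~b (step h w)

  walk-∷ʳ : ∀ {p a b c} → IsWalk G p a b → Adj G b c → IsWalk G (p ∷ʳ c) a c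
  walk-∷ʳ single     b~c = step b~c single
  walk-∷ʳ (step h w) b~c = step h (walk-∷ʳ w b~c)

  walk-reverse : ∀ {p a b} → IsWalk G p a b → IsWalk G (reverse p) b a
  walk-reverse single = single
  walk-reverse (step {a} {b} {c} {p} a~b w) =
    subst (λ q → IsWalk G q c a) (≡.sym (unfold-reverse a (b ∷ p)))
      (walk-∷ʳ (walk-reverse w) (Graph.sym G a~b))

  walk-++ : ∀ {p q a b c} → IsWalk G p a b → IsWalk G q b c → IsWalk G (p ++ drop 1 q) a c
  walk-++ single     single     = single
  walk-++ single     (step h w) = step h w
  walk-++ (step h w) w′         = walk-∷ h (walk-++ w w′)

  length-walk : ∀ {p a b} → IsWalk G p a b → length p ≡ suc (edges p)
  length-walk single     = refl
  length-walk (step _ _) = refl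

  edges-reverse : ∀ {p a b} → IsWalk G p a b → edges (reverse p) ≡ edges p
  edges-reverse {p} w = suc-injective (begin
    suc (edges (reverse p))  ≡⟨ ≡.sym (length-walk (walk-reverse w)) ⟩
    length (reverse p)       ≡⟨ length-reverse p ⟩
    length p                 ≡⟨ length-walk w ⟩
    suc (edges p)            ∎)
    where open ≡-Reasoning

  edges-++ : ∀ {p q a b c d} → IsWalk G p a b → IsWalk G q c d → edges (p ++ q) ≡ edges p + suc (edges q)
  edges-++ single     w′ = length-walk w′
  edges-++ (step _ w) w′ = cong suc (edges-++ w w′)

  edges-suffix-< : ∀ {p q a b c d} → IsWalk G p a b → IsWalk G q c d → edges q < edges (p ++ q)
  edges-suffix-< {p} {q} w w′ =
    subst (edges q <_) (≡.sym (edges-++ w w′)) (m≤n+m (suc (edges q)) (edges p))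

  edges-++-drop : ∀ {p q a b c} → IsWalk G p a b → IsWalk G q b c → edges (p ++ drop 1 q) ≡ edges p + edges q
  edges-++-drop single     single     = refl
  edges-++-drop single     (step _ _) = refl
  edges-++-drop (step _ w) w′         = cong suc (edges-++-drop w w′)

  suffix-path : ∀ {q a s t} → IsPath G q s t → a ∈ q → ∃ λ q′ → IsPath G q′ a t × edges q′ ≤ edges q
  suffix-path path@(single , _)     (here refl) = _ , path , ≤-refl
  suffix-path path@(step _ _ , _)   (here refl) = _ , path , ≤-refl
  suffix-path (step _ w , _ ∷ uniq) (there a∈q) with suffix-path (w , uniq) a∈q
  ... | q′ , path′ , q′≤q = q′ , path′ , m≤n⇒m≤1+n q′≤q

  walk⇒path : ∀ {p a b} → IsWalk G p a b → ∃ λ q → IsPath G q a b × edges q ≤ edges p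
  walk⇒path single = _ , (single , [] ∷ []) , z≤n
  walk⇒path (step {a} a~b w) with walk⇒path w
  ... | q , (wq , uq) , q≤p with a ∈? q
  ...   | yes a∈q = let q′ , path′ , q′≤q = suffix-path (wq , uq) a∈q in
    q′ , path′ , ≤-trans q′≤q (m≤n⇒m≤1+n q≤p)
  ...   | no a∉q =
    a ∷ q , (walk-∷ a~b wq , ¬Any⇒All¬ q a∉q ∷ uq) , ≤-trans (≤-reflexive (length-walk wq)) (s≤s q≤p)

  dist-≤-walk : ∀ {a b k q} → Dist G a b k → IsWalk G q a b → k ≤ edges q
  dist-≤-walk (_ , (_ , minimal) , refl) w with walk⇒path w
  ... | q′ , path′ , q′≤q = ≤-trans (minimal q′ path′) q′≤q

Dist-cong : ∀ {n} {H H′ : Graph n} {x y} →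
  (∀ p → IsShortestPath H p x y ⇔ IsShortestPath H′ p x y) → ∀ k → Dist H x y k ⇔ Dist H′ x y k
Dist-cong shortest⇔ k = mk⇔
  (λ { (p , shortest , p≡k) → p , Equivalence.to (shortest⇔ p) shortest , p≡k })
  (λ { (p , shortest , p≡k) → p , Equivalence.from (shortest⇔ p) shortest , p≡k })

module EdgeDeletion {n : ℕ} (G : Graph n) (u v : Fin n) where

  G-e : Graph n
  G-e = deleteEdge G u v

  Traverses : Fin n → Fin n → Set
  Traverses s t = s ≡ u × t ≡ v ⊎ s ≡ v × t ≡ u

  IsEnd : Fin n → Set
  IsEnd t = t ≡ u ⊎ t ≡ v

  source-end : ∀ {s t} → Traverses s t → IsEnd s
  source-end (inj₁ (s≡u , _)) = inj₁ s≡u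
  source-end (inj₂ (s≡v , _)) = inj₂ s≡v

  target-end : ∀ {s t} → Traverses s t → IsEnd t
  target-end (inj₁ (_ , t≡v)) = inj₂ t≡v
  target-end (inj₂ (_ , t≡u)) = inj₁ t≡u

  data WalkView (p : List (Fin n)) (a b : Fin n) : Set where
    avoids  : IsWalk G-e p a b → WalkView p a b
    crosses : ∀ {p₁ p₂ s t} → Traverses s t → IsWalk G p₁ a s → IsWalk G p₂ t b →
              p ≡ p₁ ++ p₂ → WalkView p a b

  walkView : ∀ {p a b} → IsWalk G p a b → WalkView p a b
  walkView single = avoids single
  walkView (step {a} {b} a~b w) with walkView w
  ... | crosses e w₁ w₂ p≡ = crosses e (walk-∷ a~b w₁) w₂ (cong (a ∷_) p≡)
  ... | avoids w′ with (a ≟ u) ×-dec (b ≟ v)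
  ...   | yes (refl , refl) = crosses (inj₁ (refl , refl)) single w refl
  ...   | no ¬uv with (a ≟ v) ×-dec (b ≟ u)
  ...     | yes (refl , refl) = crosses (inj₂ (refl , refl)) single w refl
  ...     | no ¬vu = avoids (step (a~b , ¬uv , ¬vu) w′)

  walk-lift : ∀ {p a b} → IsWalk G-e p a b → IsWalk G p a b
  walk-lift single             = single
  walk-lift (step (a~b , _) w) = step a~b (walk-lift w)

  FarFromEnds : Fin n → ℕ → Set
  FarFromEnds x k = ∀ {t q} → IsEnd t → IsWalk G q t x → k ≤ edges q

  OnUSide : Fin n → ℕ → Set
  OnUSide x k = Dist G u x k × FarFromEnds x k

  InW⊎InEq⇒OnUSide : ∀ {x} → InW G u v x ⊎ InEq G u v x → ∃ (OnUSide x)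
  InW⊎InEq⇒OnUSide (inj₁ (k , _ , du , dv , k<l)) = k , du , λ
    { (inj₁ refl) w → dist-≤-walk du w
    ; (inj₂ refl) w → ≤-trans (<⇒≤ k<l) (dist-≤-walk dv w) }
  InW⊎InEq⇒OnUSide (inj₂ (k , du , dv)) = k , du , λ
    { (inj₁ refl) → dist-≤-walk du
    ; (inj₂ refl) → dist-≤-walk dv }

  minimal-walk-avoids : ∀ {p a x} → FarFromEnds x (edges p) → IsWalk G p a x → IsWalk G-e p a x
  minimal-walk-avoids far w with walkView w
  ... | avoids w′ = w′
  ... | crosses e w₁ w₂ refl = ⊥-elim (<⇒≱ (edges-suffix-< w₁ w₂) (far (target-end e) w₂))

  crossing-walk-long : ∀ {x y k l p₁ p₂ s t} → FarFromEnds x k → FarFromEnds y l →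
    Traverses s t → IsWalk G p₁ x s → IsWalk G p₂ t y → k + l < edges (p₁ ++ p₂)
  crossing-walk-long {k = k} {l} {p₁} {p₂} far-x far-y e w₁ w₂ =
    subst (k + l <_) (≡.sym (edges-++ w₁ w₂)) (+-mono-≤-< k≤p₁ (s≤s l≤p₂))
    where
    k≤p₁ : k ≤ edges p₁
    k≤p₁ = subst (k ≤_) (edges-reverse w₁) (far-x (source-end e) (walk-reverse w₁))
    l≤p₂ : l ≤ edges p₂
    l≤p₂ = far-y (target-end e) w₂

  walk-avoids-or-long : ∀ {x y k l p} → FarFromEnds x k → FarFromEnds y l →
    IsWalk G p x y → IsWalk G-e p x y ⊎ k + l < edges p
  walk-avoids-or-long far-x far-y w with walkView w
  ... | avoids w′             = inj₁ w′
  ... | crosses e w₁ w₂ refl = inj₂ (crossing-walk-long far-x far-y e w₁ w₂)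

  geodesic-avoids : ∀ {x k} → OnUSide x k → ∃ λ p → IsWalk G-e p u x × edges p ≡ k
  geodesic-avoids ((p , ((w , _) , _) , refl) , far) = p , minimal-walk-avoids far w , refl

  walk-via-u : ∀ {x y k l} → OnUSide x k → OnUSide y l → ∃ λ p → IsWalk G-e p x y × edges p ≡ k + l
  walk-via-u x-near y-near with geodesic-avoids x-near | geodesic-avoids y-near
  ... | px , wx , refl | py , wy , refl =
    reverse px ++ drop 1 py , walk-++ (walk-reverse wx) wy , (begin
      edges (reverse px ++ drop 1 py)  ≡⟨ edges-++-drop (walk-reverse wx) wy ⟩
      edges (reverse px) + edges py    ≡⟨ cong (_+ edges py) (edges-reverse wx) ⟩
      edges px + edges py              ∎)
    where open ≡-Reasoning

  path-via-u : ∀ {x y k l} → OnUSide x k → OnUSide y l → ∃ λ r → IsPath G-e r x y × edges r ≤ k + l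
  path-via-u x-near y-near with walk-via-u x-near y-near
  ... | p , w , p≡k+l with walk⇒path w
  ...   | r , r-path , r≤p = r , r-path , ≤-trans r≤p (≤-reflexive p≡k+l)

  shortest-paths-agree : ∀ {x y r} → IsPath G-e r x y →
    (∀ {p} → IsWalk G p x y → IsWalk G-e p x y ⊎ edges r < edges p) →
    ∀ p → IsShortestPath G p x y ⇔ IsShortestPath G-e p x y
  shortest-paths-agree {x} {y} {r} (wr , ur) avoids-or-longer p = mk⇔ to from
    where
    to : IsShortestPath G p x y → IsShortestPath G-e p x y
    to ((wp , up) , minimal) with avoids-or-longer wp
    ... | inj₁ wp′ = (wp′ , up) , λ q (wq , uq) → minimal q (walk-lift wq , uq)
    ... | inj₂ r<p = ⊥-elim (<⇒≱ r<p (minimal r (walk-lift wr , ur)))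

    from : IsShortestPath G-e p x y → IsShortestPath G p x y
    from ((wp , up) , minimal) = (walk-lift wp , up) , bound
      where
      bound : ∀ q → IsPath G q x y → edges p ≤ edges q
      bound q (wq , uq) with avoids-or-longer wq
      ... | inj₁ wq′ = minimal q (wq′ , uq)
      ... | inj₂ r<q = ≤-trans (minimal r (wr , ur)) (<⇒≤ r<q)

lemma6p1 : {n : ℕ} (G : Graph n) → Connected G →
    (u v : Fin n) → Adj G u v →
    (x y : Fin n) → (InW G u v x ⊎ InEq G u v x) → (InW G u v y ⊎ InEq G u v y) →
    (∀ (p : List (Fin n)) → IsShortestPath G p x y ⇔ IsShortestPath (deleteEdge G u v) p x y)
    × (∀ (k : ℕ) → Dist G x y k ⇔ Dist (deleteEdge G u v) x y k)
lemma6p1 G _ u v _ x y x-side y-side = shortest⇔ , Dist-cong shortest⇔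
  where
  open EdgeDeletion G u v

  shortest⇔ : ∀ p → IsShortestPath G p x y ⇔ IsShortestPath G-e p x y
  shortest⇔ with InW⊎InEq⇒OnUSide x-side | InW⊎InEq⇒OnUSide y-side
  ... | k , x-near@(_ , far-x) | l , y-near@(_ , far-y) with path-via-u x-near y-near
  ...   | r , r-path , r≤k+l = shortest-paths-agree r-path λ w →
            map₂ (≤-<-trans r≤k+l) (walk-avoids-or-long far-x far-y w)
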